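{- Let $\lambda\in\mathbb{C}_p$ with $\lambda\ne0$ and $|\lambda|_p\le1$ ($p$ an odd prime), and let $r\in\mathbb{N}$. For every $n\ge0$, \[ \sum_{m=0}^nCh^{(r)}_m(x)\,S_{2,\lambda}(n,m)=\sum_{m=0}^nCh^{(r)}_{m,\lambda}(x)\,S_2(n,m). \]
   Context: $S_2(n,m)$ are the Stirling numbers of the second kind: $x^n=\sum_{m=0}^nS_2(n,m)\,x(x-1)\cdots(x-m+1)$. The degenerate Stirling numbers of the second kind are defined by $\frac1{m!}\big((1+\lambda t)^{1/\lambda}-1\big)^m=\sum_{n\ge m}S_{2,\lambda}(n,m)\frac{t^n}{n!}$ (and $S_{2,\lambda}(n,m)=0$ for $n<m$). The fermionic $p$-adic integral of a continuous $f$ on $\mathbb{Z}_p$ is $\int_{\mathbb{Z}_p}f(y)\,d\mu_{ -1}(y)=\lim_{N\to\infty}\sum_{y=0}^{p^N-1}f(y)(-1)^y$. The higher-order Changhee polynomials are $Ch^{(r)}_m(x)=\int_{\mathbb{Z}_p}\cdots\int_{\mathbb{Z}_p}(x_1+\cdots+x_r+x)_m\,d\mu_{ -1}(x_1)\cdots d\mu_{ -1}(x_r)$, where $(z)_m=z(z-1)\cdots(z-m+1)$; equivalently $\left(\frac{2}{2+t}\right)^r(1+t)^x=\sum_{m\ge0}Ch^{(r)}_m(x)\frac{t^m}{m!}$. Writing $(x)_{0,\lambda}=1$, $(x)_{n,\lambda}=x(x-\lambda)\cdots(x-(n-1)\lambda)$ and $(1+\lambda u)^{x/\lambda}=\sum_{m\ge0}(x)_{m,\lambda}u^m/m!$,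 the higher-order degenerate Changhee polynomials of the second kind are defined by $\left(\frac{2}{1+(1+\lambda\log(1+t))^{1/\lambda}}\right)^r(1+\lambda\log(1+t))^{x/\lambda}=\sum_{n\ge0}Ch^{(r)}_{n,\lambda}(x)\frac{t^n}{n!}$. -}

module Defs where

open import Level using (Level)
open import Data.Nat as ℕ using (ℕ; zero; suc; _∸_)
open import Algebra.Bundles using (CommutativeRing)

S₂ : ℕ → ℕ → ℕ
S₂ zero    zero    = 1
S₂ zero    (suc m) = 0
S₂ (suc n) zero    = 0
S₂ (suc n) (suc m) = suc m ℕ.* S₂ n (suc m) ℕ.+ S₂ n m

-- Everything below lives in a commutative ring R in which every positive
-- integer is invertible (a ℚ-algebra, e.g. ℂ_p); `inv n` is meant to be
-- the inverse of n+1 (this is imposed as a hypothesis in the theorem).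
module _ {c ℓ : Level} (R : CommutativeRing c ℓ) (inv : ℕ → CommutativeRing.Carrier R) where
  open CommutativeRing R hiding (zero)

  Series : Set c
  Series = ℕ → Carrier

  sumTo : ℕ → (ℕ → Carrier) → Carrier
  sumTo zero    f = f zero
  sumTo (suc n) f = sumTo n f + f (suc n)

  natR : ℕ → Carrier
  natR zero    = 0#
  natR (suc n) = 1# + natR n

  factR : ℕ → Carrier
  factR zero    = 1#
  factR (suc n) = natR (suc n) * factR n

  invFact : ℕ → Carrier
  invFact zero    = 1#
  invFact (suc n) = inv n * invFact n

  half : Carrier
  half = inv 1

  sign : ℕ → Carrier
  sign zero    = 1#
  sign (suc n) = - sign n

  powR : Carrier → ℕ → Carrier
  powR a zero    = 1#
  powR a (suc k) = a * powR a k

  oneS : Series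
  oneS zero    = 1#
  oneS (suc n) = 0#

  tS : Series
  tS zero          = 0#
  tS (suc zero)    = 1#
  tS (suc (suc n)) = 0#

  mulS : Series → Series → Series
  mulS f g n = sumTo n (λ k → f k * g (n ∸ k))

  powS : Series → ℕ → Series
  powS f zero    = oneS
  powS f (suc k) = mulS f (powS f k)

  -- composition f(g(t)) (used only with g(0) = 0)
  compS : Series → Series → Series
  compS f g n = sumTo n (λ k → f k * powS g k n)

  minusOneS : Series → Series
  minusOneS f zero    = f zero - 1#
  minusOneS f (suc n) = f (suc n)

  scaleS : Carrier → Series → Series
  scaleS a f n = a * f n

  falling : Carrier → ℕ → Carrier
  falling x zero    = 1#
  falling x (suc m) = falling x m * (x - natR m)

  degFalling : Carrier → Carrier → ℕ → Carrier
  degFalling x lam zero    = 1#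
  degFalling x lam (suc m) = degFalling x lam m * (x - natR m * lam)

  -- (1+t)^x = Σ (x)_m t^m/m!
  binomS : Carrier → Series
  binomS x m = falling x m * invFact m

  -- (1+λu)^{x/λ} = Σ (x)_{m,λ} u^m/m!
  degPowS : Carrier → Carrier → Series
  degPowS x lam m = degFalling x lam m * invFact m

  -- log(1+t) = Σ_{n≥1} (-1)^{n-1} t^n / n
  log1pS : Series
  log1pS zero    = 0#
  log1pS (suc n) = sign n * inv n

  -- 2/(2+u) = 1/(1+u/2) = Σ_k (-1/2)^k u^k   (for u with u(0)=0)
  recip2S : Series → Series
  recip2S u = compS (λ k → powR (- half) k) u

  -- higher-order Changhee polynomials:
  -- (2/(2+t))^r (1+t)^x = Σ Ch^{(r)}_m(x) t^m/m!
  Ch : ℕ → Carrier → ℕ → Carrier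
  Ch r x m = factR m * mulS (powS (recip2S tS) r) (binomS x) m

  -- (1+λ log(1+t))^{x/λ}
  degLogPowS : Carrier → Carrier → Series
  degLogPowS x lam = compS (degPowS x lam) log1pS

  -- higher-order degenerate Changhee polynomials of the second kind:
  -- (2/(1+(1+λlog(1+t))^{1/λ}))^r (1+λlog(1+t))^{x/λ} = Σ Ch^{(r)}_{n,λ}(x) t^n/n!
  -- (note 1 + F = 2 + (F - 1) with F - 1 having zero constant term)
  ChDeg : ℕ → Carrier → Carrier → ℕ → Carrier
  ChDeg r lam x n =
    factR n * mulS (powS (recip2S (minusOneS (degLogPowS 1# lam))) r) (degLogPowS x lam) n

  -- degenerate Stirling numbers of the second kind:
  -- (1/m!)((1+λt)^{1/λ} - 1)^m = Σ_n S_{2,λ}(n,m) t^n/n!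
  S₂λ : Carrier → ℕ → ℕ → Carrier
  S₂λ lam n m = factR n * (invFact m * powS (minusOneS (degPowS 1# lam)) m n)

module Submission where

-- Both sides of the identity are n! [tⁿ] of the same power series
--     T = (2/(1 + e_λ))^r e_λ^x,   where e_λ^x(t) = (1 + λt)^{x/λ}, e_λ = e_λ^1,
-- written as a composition in two ways.  With Eλ = e_λ - 1 and G = e^t - 1:
--   * T = A ∘ Eλ for A(u) = (2/(2+u))^r (1+u)^x, the generating function of
--     Ch^{(r)}_m(x), and S_{2,λ}(n,m) = n! [tⁿ] Eλ^m/m!;
--   * T = B ∘ G for B(u) = (2/(1 + e_λ(log(1+u))))^r e_λ^x(log(1+u)), the
--     generating function of Ch^{(r)}_{m,λ}(x), since log(1 + G) = t; and
--     S₂(n,m) = n! [tⁿ] G^m/m!.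
-- Since n! [tⁿ] P(H) = Σ_m (m! P_m)(n! [tⁿ] H^m/m!), both sums equal n! [tⁿ] T.

open import Defs
open import Level using (Level)
open import Data.Nat using (ℕ; suc)
open import Algebra.Bundles using (CommutativeRing)
open import Relation.Nullary using (¬_)

open import Data.Nat as ℕ using (zero; _≤_; _<_; z≤n; s≤s; _∸_)
import Data.Nat.Properties as ℕP
open import Data.Product using (_×_; _,_; proj₁)
open import Data.Empty using (⊥-elim)
open import Relation.Nullary using (yes; no)
open import Relation.Binary.PropositionalEquality as P using (_≡_)
import Relation.Binary.Reasoning.Setoid as SetoidReasoning
import Algebra.Properties.CommutativeSemigroup as CommSemigroupProperties

-- Formal power series over an arbitrary commutative ring R.  The parameter
-- inv only occurs because the definitions in Defs carry it; nothing in this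
-- module assumes anything about it.
module PowerSeries {c ℓ : Level} (R : CommutativeRing c ℓ)
                   (inv : ℕ → CommutativeRing.Carrier R) where

  open CommutativeRing R hiding (zero)
  open SetoidReasoning setoid
  open CommSemigroupProperties *-commutativeSemigroup using (x∙yz≈y∙xz)
  open CommSemigroupProperties +-commutativeSemigroup
    using () renaming (interchange to +-interchange)

  ≡⇒≈ : ∀ {a b} → a ≡ b → a ≈ b
  ≡⇒≈ P.refl = refl

  minus-plus : ∀ a b → (a - b) + b ≈ a
  minus-plus a b = begin
    (a - b) + b   ≈⟨ +-assoc a (- b) b ⟩
    a + (- b + b) ≈⟨ +-congˡ (-‿inverseˡ b) ⟩
    a + 0#        ≈⟨ +-identityʳ a ⟩
    a             ∎

  +-cancelʳ : ∀ {a a′} b → a + b ≈ a′ + b → a ≈ a′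
  +-cancelʳ {a} {a′} b h = begin
    a             ≈⟨ sym (plus-minus a) ⟩
    (a + b) - b   ≈⟨ +-congʳ h ⟩
    (a′ + b) - b  ≈⟨ plus-minus a′ ⟩
    a′            ∎
    where
    plus-minus : ∀ a → (a + b) - b ≈ a
    plus-minus a = trans (+-assoc a b (- b))
                         (trans (+-congˡ (-‿inverseʳ b)) (+-identityʳ a))

  nat : ℕ → Carrier
  nat = natR R inv

  nat-+ : ∀ a b → nat (a ℕ.+ b) ≈ nat a + nat b
  nat-+ zero    b = sym (+-identityˡ _)
  nat-+ (suc a) b = trans (+-congˡ (nat-+ a b)) (sym (+-assoc _ _ _))

  nat-* : ∀ a b → nat (a ℕ.* b) ≈ nat a * nat b
  nat-* zero    b = sym (zeroˡ _)
  nat-* (suc a) b = begin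
    nat (b ℕ.+ a ℕ.* b)          ≈⟨ nat-+ b (a ℕ.* b) ⟩
    nat b + nat (a ℕ.* b)        ≈⟨ +-cong (sym (*-identityˡ _)) (nat-* a b) ⟩
    1# * nat b + nat a * nat b   ≈⟨ sym (distribʳ _ _ _) ⟩
    nat (suc a) * nat b          ∎

  ∑ : ℕ → (ℕ → Carrier) → Carrier
  ∑ = sumTo R inv

  ∑-cong : ∀ n {f g} → (∀ k → k ≤ n → f k ≈ g k) → ∑ n f ≈ ∑ n g
  ∑-cong zero    h = h 0 z≤n
  ∑-cong (suc n) h = +-cong (∑-cong n (λ k k≤n → h k (ℕP.m≤n⇒m≤1+n k≤n)))
                            (h (suc n) ℕP.≤-refl)

  ∑-cong′ : ∀ n {f g} → (∀ k → f k ≈ g k) → ∑ n f ≈ ∑ n g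
  ∑-cong′ n h = ∑-cong n (λ k _ → h k)

  ∑-+ : ∀ n f g → ∑ n (λ k → f k + g k) ≈ ∑ n f + ∑ n g
  ∑-+ zero    f g = refl
  ∑-+ (suc n) f g = trans (+-congʳ (∑-+ n f g)) (+-interchange _ _ _ _)

  ∑-*ˡ : ∀ n a f → a * ∑ n f ≈ ∑ n (λ k → a * f k)
  ∑-*ˡ zero    a f = refl
  ∑-*ˡ (suc n) a f = trans (distribˡ a _ _) (+-congʳ (∑-*ˡ n a f))

  ∑-*ʳ : ∀ n a f → ∑ n f * a ≈ ∑ n (λ k → f k * a)
  ∑-*ʳ n a f = trans (*-comm _ a)
                     (trans (∑-*ˡ n a f) (∑-cong′ n (λ k → *-comm a (f k))))

  ∑-zero : ∀ n f → (∀ k → k ≤ n → f k ≈ 0#) → ∑ n f ≈ 0#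
  ∑-zero n f h = trans (∑-cong n h) (all-zero n)
    where
    all-zero : ∀ n → ∑ n (λ _ → 0#) ≈ 0#
    all-zero zero    = refl
    all-zero (suc n) = trans (+-identityʳ _) (all-zero n)

  ∑-swap : ∀ n m (a : ℕ → ℕ → Carrier) →
           ∑ n (λ i → ∑ m (λ j → a i j)) ≈ ∑ m (λ j → ∑ n (λ i → a i j))
  ∑-swap zero    m a = refl
  ∑-swap (suc n) m a = trans (+-congʳ (∑-swap n m a)) (sym (∑-+ m _ _))

  ∑-shift : ∀ n f → ∑ (suc n) f ≈ f 0 + ∑ n (λ k → f (suc k))
  ∑-shift zero    f = refl
  ∑-shift (suc n) f = trans (+-congʳ (∑-shift n f)) (+-assoc _ _ _)

  ∑-trunc : ∀ {n N} f → n ≤ N → (∀ k → n < k → k ≤ N → f k ≈ 0#) →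
            ∑ N f ≈ ∑ n f
  ∑-trunc f n≤N = go f (ℕP.≤⇒≤′ n≤N)
    where
    go : ∀ {n N} f → n ℕ.≤′ N → (∀ k → n < k → k ≤ N → f k ≈ 0#) →
         ∑ N f ≈ ∑ n f
    go f ℕ.≤′-refl h = refl
    go {n} {suc N} f (ℕ.≤′-step n≤′N) h = begin
      ∑ N f + f (suc N) ≈⟨ +-cong (go f n≤′N (λ k n<k k≤N → h k n<k (ℕP.m≤n⇒m≤1+n k≤N)))
                                  (h (suc N) (s≤s (ℕP.≤′⇒≤ n≤′N)) ℕP.≤-refl) ⟩
      ∑ n f + 0#        ≈⟨ +-identityʳ _ ⟩
      ∑ n f             ∎

  -- The Kronecker delta.  It turns the triangular sums of Cauchy products
  -- into sums over full squares and cubes, whose summations commute.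

  δ : ℕ → ℕ → Carrier
  δ zero    zero    = 1#
  δ zero    (suc b) = 0#
  δ (suc a) zero    = 0#
  δ (suc a) (suc b) = δ a b

  δ-refl : ∀ a → δ a a ≡ 1#
  δ-refl zero    = P.refl
  δ-refl (suc a) = δ-refl a

  δ-≢ : ∀ a b → ¬ a ≡ b → δ a b ≡ 0#
  δ-≢ zero    zero    a≢b = ⊥-elim (a≢b P.refl)
  δ-≢ zero    (suc b) a≢b = P.refl
  δ-≢ (suc a) zero    a≢b = P.refl
  δ-≢ (suc a) (suc b) a≢b = δ-≢ a b (λ a≡b → a≢b (P.cong suc a≡b))

  δ-< : ∀ a b → a < b → δ a b ≡ 0#
  δ-< a b a<b = δ-≢ a b (ℕP.<⇒≢ a<b)

  δ-> : ∀ a b → b < a → δ a b ≡ 0#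
  δ-> a b b<a = δ-≢ a b (λ a≡b → ℕP.<⇒≢ b<a (P.sym a≡b))

  δ-sym : ∀ a b → δ a b ≡ δ b a
  δ-sym zero    zero    = P.refl
  δ-sym zero    (suc b) = P.refl
  δ-sym (suc a) zero    = P.refl
  δ-sym (suc a) (suc b) = δ-sym a b

  δ-+ : ∀ i j m → δ (i ℕ.+ j) (i ℕ.+ m) ≡ δ j m
  δ-+ zero    j m = P.refl
  δ-+ (suc i) j m = δ-+ i j m

  δ-subst : ∀ a b (X : ℕ → Carrier) → δ a b * X b ≈ δ a b * X a
  δ-subst a b X with a ℕ.≟ b
  ... | yes P.refl = refl
  ... | no a≢b     = begin
    δ a b * X b ≈⟨ *-congʳ (≡⇒≈ (δ-≢ a b a≢b)) ⟩
    0# * X b    ≈⟨ zeroˡ _ ⟩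
    0#          ≈⟨ sym (zeroˡ _) ⟩
    0# * X a    ≈⟨ *-congʳ (≡⇒≈ (P.sym (δ-≢ a b a≢b))) ⟩
    δ a b * X a ∎

  δ>-kills : ∀ a b X → b < a → δ a b * X ≈ 0#
  δ>-kills a b X b<a = trans (*-congʳ (≡⇒≈ (δ-> a b b<a))) (zeroˡ X)

  ∑-δ-out : ∀ n c (X : ℕ → Carrier) → n < c → ∑ n (λ m → δ c m * X m) ≈ 0#
  ∑-δ-out n c X n<c =
    ∑-zero n _ (λ k k≤n → δ>-kills c k (X k) (ℕP.≤-<-trans k≤n n<c))

  ∑-δ : ∀ n c (X : ℕ → Carrier) → c ≤ n → ∑ n (λ m → δ c m * X m) ≈ X c
  ∑-δ n c X c≤n = trans (∑-trunc _ c≤n beyond) (upto c)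
    where
    beyond : ∀ k → c < k → k ≤ n → δ c k * X k ≈ 0#
    beyond k c<k _ = trans (*-congʳ (≡⇒≈ (δ-< c k c<k))) (zeroˡ _)
    upto : ∀ c → ∑ c (λ m → δ c m * X m) ≈ X c
    upto zero    = *-identityˡ _
    upto (suc c) = begin
      ∑ c (λ m → δ (suc c) m * X m) + δ c c * X (suc c)
        ≈⟨ +-cong (∑-δ-out c (suc c) X ℕP.≤-refl)
                  (trans (*-congʳ (≡⇒≈ (δ-refl c))) (*-identityˡ _)) ⟩
      0# + X (suc c) ≈⟨ +-identityˡ _ ⟩
      X (suc c)      ∎

  ∑-δ′ : ∀ n c (X : ℕ → Carrier) → (n < c → X c ≈ 0#) →
         ∑ n (λ m → δ c m * X m) ≈ X c
  ∑-δ′ n c X h with c ℕP.≤? n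
  ... | yes c≤n = ∑-δ n c X c≤n
  ... | no  c≰n = trans (∑-δ-out n c X (ℕP.≰⇒> c≰n)) (sym (h (ℕP.≰⇒> c≰n)))

  ∑-δ-conv : ∀ n c (X : ℕ → Carrier) →
             ∑ n (λ k → δ c k * X (n ∸ k)) ≈ ∑ n (λ l → δ (c ℕ.+ l) n * X l)
  ∑-δ-conv n c X with c ℕP.≤? n
  ... | yes c≤n = begin
    ∑ n (λ k → δ c k * X (n ∸ k))       ≈⟨ ∑-δ n c (λ k → X (n ∸ k)) c≤n ⟩
    X (n ∸ c)                           ≈⟨ sym (∑-δ n (n ∸ c) X (ℕP.m∸n≤m n c)) ⟩
    ∑ n (λ l → δ (n ∸ c) l * X l)       ≈⟨ ∑-cong′ n (λ l → *-congʳ (≡⇒≈ (P.sym (shift l)))) ⟩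
    ∑ n (λ l → δ (c ℕ.+ l) n * X l)     ∎
    where
    shift : ∀ l → δ (c ℕ.+ l) n ≡ δ (n ∸ c) l
    shift l = P.trans (P.cong (δ (c ℕ.+ l)) (P.sym (ℕP.m+[n∸m]≡n c≤n)))
                        (P.trans (δ-+ c l (n ∸ c)) (δ-sym l (n ∸ c)))
  ... | no c≰n = begin
    ∑ n (λ k → δ c k * X (n ∸ k))   ≈⟨ ∑-δ-out n c _ n<c ⟩
    0#                              ≈⟨ sym (∑-zero n _ (λ l _ → δ>-kills (c ℕ.+ l) n (X l)
                                           (ℕP.<-≤-trans n<c (ℕP.m≤m+n c l)))) ⟩
    ∑ n (λ l → δ (c ℕ.+ l) n * X l) ∎
    where
    n<c : n < c
    n<c = ℕP.≰⇒> c≰n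

  PS : Set c
  PS = Series R inv

  infix  4 _≋_
  infixl 6 _⊞_
  infixl 7 _⊛_
  infixr 7 _·ˢ_
  infixr 8 _^ˢ_
  infixr 9 _∘ˢ_

  _≋_ : PS → PS → Set ℓ
  f ≋ g = ∀ n → f n ≈ g n

  ≋-refl : ∀ {f} → f ≋ f
  ≋-refl n = refl

  ≋-sym : ∀ {f g} → f ≋ g → g ≋ f
  ≋-sym f≋g n = sym (f≋g n)

  ≋-trans : ∀ {f g h} → f ≋ g → g ≋ h → f ≋ h
  ≋-trans f≋g g≋h n = trans (f≋g n) (g≋h n)

  _⊞_ : PS → PS → PS
  (f ⊞ g) n = f n + g n

  _·ˢ_ : Carrier → PS → PS
  _·ˢ_ = scaleS R inv

  _⊛_ : PS → PS → PS
  _⊛_ = mulS R inv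

  _^ˢ_ : PS → ℕ → PS
  _^ˢ_ = powS R inv

  _∘ˢ_ : PS → PS → PS
  _∘ˢ_ = compS R inv

  𝟙 : PS
  𝟙 = oneS R inv

  t : PS
  t = tS R inv

  𝟙-δ : ∀ k → 𝟙 k ≡ δ 0 k
  𝟙-δ zero    = P.refl
  𝟙-δ (suc k) = P.refl

  t-δ : ∀ k → t k ≡ δ 1 k
  t-δ zero          = P.refl
  t-δ (suc zero)    = P.refl
  t-δ (suc (suc k)) = P.refl

  squareSum : ℕ → (ℕ → ℕ → Carrier) → ℕ → Carrier
  squareSum N F n = ∑ N (λ i → ∑ N (λ j → δ (i ℕ.+ j) n * F i j))

  ⊛-square : ∀ f g n → (f ⊛ g) n ≈ squareSum n (λ i j → f i * g j) n
  ⊛-square f g n = sym (∑-cong n inner)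
    where
    inner : ∀ i → i ≤ n →
            ∑ n (λ j → δ (i ℕ.+ j) n * (f i * g j)) ≈ f i * g (n ∸ i)
    inner i i≤n = trans (sym (∑-δ-conv n i (λ j → f i * g j)))
                        (∑-δ n i (λ k → f i * g (n ∸ k)) i≤n)

  squareSum-widen : ∀ m N F → m ≤ N → squareSum m F m ≈ squareSum N F m
  squareSum-widen m N F m≤N = begin
    ∑ m (λ i → ∑ m (row i))  ≈⟨ ∑-cong m (λ i i≤m → sym (∑-trunc (row i) m≤N
                                  (λ j m<j _ → kill (ℕP.<-≤-trans m<j (ℕP.m≤n+m j i))))) ⟩
    ∑ m (λ i → ∑ N (row i))  ≈⟨ sym (∑-trunc (λ i → ∑ N (row i)) m≤N
                                  (λ i m<i _ → ∑-zero N _ (λ j _ →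
                                     kill (ℕP.<-≤-trans m<i (ℕP.m≤m+n i j))))) ⟩
    ∑ N (λ i → ∑ N (row i))  ∎
    where
    row : ℕ → ℕ → Carrier
    row i j = δ (i ℕ.+ j) m * F i j
    kill : ∀ {i j} → m < i ℕ.+ j → row i j ≈ 0#
    kill {i} {j} = δ>-kills (i ℕ.+ j) m (F i j)

  ⊛-cong : ∀ {f f′ g g′} → f ≋ f′ → g ≋ g′ → f ⊛ g ≋ f′ ⊛ g′
  ⊛-cong f≋f′ g≋g′ n = ∑-cong′ n (λ k → *-cong (f≋f′ k) (g≋g′ (n ∸ k)))

  ⊛-local : ∀ n {f f′ g g′} → (∀ m → m ≤ n → f m ≈ f′ m) →
            (∀ m → m ≤ n → g m ≈ g′ m) → (f ⊛ g) n ≈ (f′ ⊛ g′) n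
  ⊛-local n f≈f′ g≈g′ =
    ∑-cong n (λ k k≤n → *-cong (f≈f′ k k≤n) (g≈g′ (n ∸ k) (ℕP.m∸n≤m n k)))

  -- Commutativity: the square sum is symmetric under swapping (i, j).
  ⊛-comm : ∀ f g → f ⊛ g ≋ g ⊛ f
  ⊛-comm f g n = begin
    (f ⊛ g) n                                          ≈⟨ ⊛-square f g n ⟩
    squareSum n (λ i j → f i * g j) n                  ≈⟨ ∑-swap n n _ ⟩
    ∑ n (λ j → ∑ n (λ i → δ (i ℕ.+ j) n * (f i * g j)))
      ≈⟨ ∑-cong′ n (λ j → ∑-cong′ n (λ i →
           *-cong (≡⇒≈ (P.cong (λ s → δ s n) (ℕP.+-comm i j))) (*-comm (f i) (g j)))) ⟩
    squareSum n (λ j i → g j * f i) n                  ≈⟨ sym (⊛-square g f n) ⟩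
    (g ⊛ f) n                                          ∎

  ⊛-distribˡ : ∀ f g h → f ⊛ (g ⊞ h) ≋ f ⊛ g ⊞ f ⊛ h
  ⊛-distribˡ f g h n = trans (∑-cong′ n (λ k → distribˡ (f k) _ _)) (∑-+ n _ _)

  ⊛-distribʳ : ∀ f g h → (g ⊞ h) ⊛ f ≋ g ⊛ f ⊞ h ⊛ f
  ⊛-distribʳ f g h n = trans (∑-cong′ n (λ k → distribʳ (f (n ∸ k)) _ _)) (∑-+ n _ _)

  ⊛-·ˡ : ∀ a f g → (a ·ˢ f) ⊛ g ≋ a ·ˢ (f ⊛ g)
  ⊛-·ˡ a f g n = trans (∑-cong′ n (λ k → *-assoc a (f k) _)) (sym (∑-*ˡ n a _))

  ⊛-·ʳ : ∀ a f g → f ⊛ (a ·ˢ g) ≋ a ·ˢ (f ⊛ g)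
  ⊛-·ʳ a f g n = trans (∑-cong′ n (λ k → x∙yz≈y∙xz (f k) a _)) (sym (∑-*ˡ n a _))

  ⊛-identityˡ : ∀ f → 𝟙 ⊛ f ≋ f
  ⊛-identityˡ f n = trans (∑-cong′ n (λ k → *-congʳ (≡⇒≈ (𝟙-δ k))))
                          (∑-δ n 0 (λ k → f (n ∸ k)) z≤n)

  ⊛-identityʳ : ∀ f → f ⊛ 𝟙 ≋ f
  ⊛-identityʳ f = ≋-trans (⊛-comm f 𝟙) (⊛-identityˡ f)

  t⊛-zero : ∀ f → (t ⊛ f) 0 ≈ 0#
  t⊛-zero f = zeroˡ _

  t⊛-suc : ∀ f n → (t ⊛ f) (suc n) ≈ f n
  t⊛-suc f n = trans (∑-cong′ (suc n) (λ k → *-congʳ (≡⇒≈ (t-δ k))))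
                     (∑-δ (suc n) 1 (λ k → f (suc n ∸ k)) (s≤s z≤n))

  ⊛-∑ˡ : ∀ N n (a : ℕ → PS) g →
         ((λ m → ∑ N (λ i → a i m)) ⊛ g) n ≈ ∑ N (λ i → (a i ⊛ g) n)
  ⊛-∑ˡ N n a g = trans (∑-cong′ n (λ k → ∑-*ʳ N _ _)) (∑-swap n N _)

  ⊛-∑ʳ : ∀ N n (a : ℕ → PS) f →
         (f ⊛ (λ m → ∑ N (λ i → a i m))) n ≈ ∑ N (λ i → (f ⊛ a i) n)
  ⊛-∑ʳ N n a f = trans (∑-cong′ n (λ k → ∑-*ˡ N _ _)) (∑-swap n N _)

  cubeSum : ℕ → (ℕ → ℕ → ℕ → Carrier) → Carrier
  cubeSum n F = ∑ n (λ i → ∑ n (λ j → ∑ n (λ l → δ ((i ℕ.+ j) ℕ.+ l) n * F i j l)))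

  ⊛-cube : ∀ f g h n → ((f ⊛ g) ⊛ h) n ≈ cubeSum n (λ i j l → (f i * g j) * h l)
  ⊛-cube f g h n = begin
    ((f ⊛ g) ⊛ h) n
      ≈⟨ ∑-cong n (λ k k≤n → *-congʳ (trans (⊛-square f g k) (squareSum-widen k n _ k≤n))) ⟩
    ∑ n (λ k → squareSum n F k * h (n ∸ k))
      ≈⟨ ∑-cong′ n (λ k → trans (∑-*ʳ n _ _) (∑-cong′ n (λ i →
           trans (∑-*ʳ n _ _) (∑-cong′ n (λ j → *-assoc _ _ _))))) ⟩
    ∑ n (λ k → ∑ n (λ i → ∑ n (λ j → δ (i ℕ.+ j) k * (F i j * h (n ∸ k)))))
      ≈⟨ trans (∑-swap n n _) (∑-cong′ n (λ i → ∑-swap n n _)) ⟩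
    ∑ n (λ i → ∑ n (λ j → ∑ n (λ k → δ (i ℕ.+ j) k * (F i j * h (n ∸ k)))))
      ≈⟨ ∑-cong′ n (λ i → ∑-cong′ n (λ j → ∑-δ-conv n (i ℕ.+ j) (λ l → F i j * h l))) ⟩
    cubeSum n (λ i j l → F i j * h l) ∎
    where
    F : ℕ → ℕ → Carrier
    F i j = f i * g j

  -- Associativity: the cube sum is invariant under the cyclic permutation
  -- (i, j, l) ↦ (j, l, i) of its indices.
  ⊛-assoc : ∀ f g h → (f ⊛ g) ⊛ h ≋ f ⊛ (g ⊛ h)
  ⊛-assoc f g h n = begin
    ((f ⊛ g) ⊛ h) n                                ≈⟨ ⊛-cube f g h n ⟩
    cubeSum n (λ i j l → (f i * g j) * h l)
      ≈⟨ ∑-cong′ n (λ i → ∑-cong′ n (λ j → ∑-cong′ n (λ l →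
           *-cong (≡⇒≈ (P.cong (λ s → δ s n) (rotate i j l)))
                  (trans (*-assoc _ _ _) (*-comm _ _))))) ⟩
    ∑ n (λ i → ∑ n (λ j → ∑ n (λ l → δ ((j ℕ.+ l) ℕ.+ i) n * ((g j * h l) * f i))))
      ≈⟨ trans (∑-cong′ n (λ i → ∑-swap n n _)) (trans (∑-swap n n _)
           (trans (∑-cong′ n (λ l → ∑-swap n n _)) (∑-swap n n _))) ⟩
    cubeSum n (λ j l i → (g j * h l) * f i)         ≈⟨ sym (⊛-cube g h f n) ⟩
    ((g ⊛ h) ⊛ f) n                                ≈⟨ ⊛-comm (g ⊛ h) f n ⟩
    (f ⊛ (g ⊛ h)) n                                ∎
    where
    rotate : ∀ i j l → (i ℕ.+ j) ℕ.+ l ≡ (j ℕ.+ l) ℕ.+ i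
    rotate i j l = P.trans (ℕP.+-assoc i j l) (ℕP.+-comm i (j ℕ.+ l))

  ⊛-leftComm : ∀ f g h → f ⊛ (g ⊛ h) ≋ g ⊛ (f ⊛ h)
  ⊛-leftComm f g h = ≋-trans (≋-sym (⊛-assoc f g h))
                    (≋-trans (⊛-cong {g = h} (⊛-comm f g) ≋-refl) (⊛-assoc g f h))

  -- Powers and composition.  Composition f ∘ˢ G is only meaningful when G
  -- has constant term 0; then G^k starts at t^k, so the n-th coefficient
  -- of f ∘ˢ G = Σ_k f_k G^k involves only k ≤ n.

  ConstFree : PS → Set ℓ
  ConstFree G = G 0 ≈ 0#

  ^ˢ-cong : ∀ {f f′} → f ≋ f′ → ∀ k → f ^ˢ k ≋ f′ ^ˢ k
  ^ˢ-cong f≋f′ zero    = ≋-refl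
  ^ˢ-cong f≋f′ (suc k) = ⊛-cong f≋f′ (^ˢ-cong f≋f′ k)

  ^ˢ-+ : ∀ f i j → f ^ˢ (i ℕ.+ j) ≋ (f ^ˢ i) ⊛ (f ^ˢ j)
  ^ˢ-+ f zero    j = ≋-sym (⊛-identityˡ (f ^ˢ j))
  ^ˢ-+ f (suc i) j = ≋-trans (⊛-cong ≋-refl (^ˢ-+ f i j))
                             (≋-sym (⊛-assoc f (f ^ˢ i) (f ^ˢ j)))

  ^ˢ-low : ∀ G → ConstFree G → ∀ k n → n < k → (G ^ˢ k) n ≈ 0#
  ^ˢ-low G G₀ (suc k) n (s≤s n≤k) = ∑-zero n _ term
    where
    term : ∀ i → i ≤ n → G i * (G ^ˢ k) (n ∸ i) ≈ 0#
    term zero    _    = trans (*-congʳ G₀) (zeroˡ _)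
    term (suc i) i<n = trans (*-congˡ (^ˢ-low G G₀ k (n ∸ suc i) n∸i<k)) (zeroʳ _)
      where n∸i<k = ℕP.<-≤-trans (ℕP.∸-monoʳ-< {n} {suc i} {0} (s≤s z≤n) i<n) n≤k

  t^ˢ : ∀ k n → (t ^ˢ k) n ≈ δ k n
  t^ˢ zero    n       = ≡⇒≈ (𝟙-δ n)
  t^ˢ (suc k) zero    = t⊛-zero (t ^ˢ k)
  t^ˢ (suc k) (suc n) = trans (t⊛-suc (t ^ˢ k) n) (t^ˢ k n)

  ∘ˢ-widen : ∀ f G → ConstFree G → ∀ n N → n ≤ N →
             (f ∘ˢ G) n ≈ ∑ N (λ k → f k * (G ^ˢ k) n)
  ∘ˢ-widen f G G₀ n N n≤N = sym (∑-trunc _ n≤N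
    (λ k n<k _ → trans (*-congˡ (^ˢ-low G G₀ k n n<k)) (zeroʳ _)))

  ∘ˢ-congˡ : ∀ {f f′} G → f ≋ f′ → f ∘ˢ G ≋ f′ ∘ˢ G
  ∘ˢ-congˡ G f≋f′ n = ∑-cong′ n (λ k → *-congʳ (f≋f′ k))

  ∘ˢ-congʳ : ∀ f {G G′} → G ≋ G′ → f ∘ˢ G ≋ f ∘ˢ G′
  ∘ˢ-congʳ f G≋G′ n = ∑-cong′ n (λ k → *-congˡ (^ˢ-cong G≋G′ k n))

  ∘ˢ-⊞ : ∀ f g G → (f ⊞ g) ∘ˢ G ≋ f ∘ˢ G ⊞ g ∘ˢ G
  ∘ˢ-⊞ f g G n = trans (∑-cong′ n (λ k → distribʳ _ _ _)) (∑-+ n _ _)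

  ∘ˢ-· : ∀ a f G → (a ·ˢ f) ∘ˢ G ≋ a ·ˢ (f ∘ˢ G)
  ∘ˢ-· a f G n = trans (∑-cong′ n (λ k → *-assoc _ _ _)) (sym (∑-*ˡ n a _))

  𝟙∘ˢ : ∀ G → 𝟙 ∘ˢ G ≋ 𝟙
  𝟙∘ˢ G n = trans (∑-cong′ n (λ k → *-congʳ (≡⇒≈ (𝟙-δ k))))
                  (∑-δ n 0 (λ k → (G ^ˢ k) n) z≤n)

  t∘ˢ : ∀ G → ConstFree G → t ∘ˢ G ≋ G
  t∘ˢ G G₀ n = begin
    (t ∘ˢ G) n                          ≈⟨ ∑-cong′ n (λ k → *-congʳ (≡⇒≈ (t-δ k))) ⟩
    ∑ n (λ k → δ 1 k * (G ^ˢ k) n)       ≈⟨ ∑-δ′ n 1 (λ k → (G ^ˢ k) n) (^ˢ-low G G₀ 1 n) ⟩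
    (G ⊛ 𝟙) n                           ≈⟨ ⊛-identityʳ G n ⟩
    G n                                 ∎

  ∘ˢt : ∀ f → f ∘ˢ t ≋ f
  ∘ˢt f n = begin
    (f ∘ˢ t) n
      ≈⟨ ∑-cong′ n (λ k → trans (*-congˡ (trans (t^ˢ k n) (≡⇒≈ (δ-sym k n)))) (*-comm _ _)) ⟩
    ∑ n (λ k → δ n k * f k)
      ≈⟨ ∑-δ n n f ℕP.≤-refl ⟩
    f n ∎

  -- Both (f ⊛ g) ∘ˢ G and (f ∘ˢ G) ⊛ (g ∘ˢ G) expand to Σ_{i,j} f_i g_j G^{i+j}.
  ⊛∘ˢ-expand : ∀ f g G → ConstFree G → ∀ n →
    ((f ⊛ g) ∘ˢ G) n ≈ ∑ n (λ i → ∑ n (λ j → (f i * g j) * (G ^ˢ (i ℕ.+ j)) n))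
  ⊛∘ˢ-expand f g G G₀ n = begin
    ((f ⊛ g) ∘ˢ G) n
      ≈⟨ ∑-cong n (λ k k≤n → *-congʳ (trans (⊛-square f g k) (squareSum-widen k n _ k≤n))) ⟩
    ∑ n (λ k → squareSum n (λ i j → f i * g j) k * (G ^ˢ k) n)
      ≈⟨ ∑-cong′ n (λ k → trans (∑-*ʳ n _ _) (∑-cong′ n (λ i →
           trans (∑-*ʳ n _ _) (∑-cong′ n (λ j → *-assoc _ _ _))))) ⟩
    ∑ n (λ k → ∑ n (λ i → ∑ n (λ j → δ (i ℕ.+ j) k * ((f i * g j) * (G ^ˢ k) n))))
      ≈⟨ trans (∑-swap n n _) (∑-cong′ n (λ i → ∑-swap n n _)) ⟩
    ∑ n (λ i → ∑ n (λ j → ∑ n (λ k → δ (i ℕ.+ j) k * ((f i * g j) * (G ^ˢ k) n))))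
      ≈⟨ ∑-cong′ n (λ i → ∑-cong′ n (λ j → ∑-δ′ n (i ℕ.+ j) _ (λ n<i+j →
           trans (*-congˡ (^ˢ-low G G₀ (i ℕ.+ j) n n<i+j)) (zeroʳ _)))) ⟩
    ∑ n (λ i → ∑ n (λ j → (f i * g j) * (G ^ˢ (i ℕ.+ j)) n)) ∎

  ∘ˢ⊛∘ˢ-expand : ∀ f g G → ConstFree G → ∀ n →
    ((f ∘ˢ G) ⊛ (g ∘ˢ G)) n ≈ ∑ n (λ i → ∑ n (λ j → (f i * g j) * (G ^ˢ (i ℕ.+ j)) n))
  ∘ˢ⊛∘ˢ-expand f g G G₀ n = begin
    ((f ∘ˢ G) ⊛ (g ∘ˢ G)) n
      ≈⟨ ⊛-local n (λ m m≤n → ∘ˢ-widen f G G₀ m n m≤n)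
                   (λ m m≤n → ∘ˢ-widen g G G₀ m n m≤n) ⟩
    ((λ m → ∑ n (λ i → f i * (G ^ˢ i) m)) ⊛ (λ m → ∑ n (λ j → g j * (G ^ˢ j) m))) n
      ≈⟨ trans (⊛-∑ˡ n n (λ i → f i ·ˢ G ^ˢ i) (λ m → ∑ n (λ j → g j * (G ^ˢ j) m)))
               (∑-cong′ n (λ i → ⊛-∑ʳ n n (λ j → g j ·ˢ G ^ˢ j) _)) ⟩
    ∑ n (λ i → ∑ n (λ j → ((f i ·ˢ G ^ˢ i) ⊛ (g j ·ˢ G ^ˢ j)) n))
      ≈⟨ ∑-cong′ n (λ i → ∑-cong′ n (λ j → scaled-product (f i) (g j) i j)) ⟩
    ∑ n (λ i → ∑ n (λ j → (f i * g j) * (G ^ˢ (i ℕ.+ j)) n)) ∎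
    where
    scaled-product : ∀ a b i j →
      ((a ·ˢ G ^ˢ i) ⊛ (b ·ˢ G ^ˢ j)) n ≈ (a * b) * (G ^ˢ (i ℕ.+ j)) n
    scaled-product a b i j = begin
      ((a ·ˢ G ^ˢ i) ⊛ (b ·ˢ G ^ˢ j)) n  ≈⟨ ⊛-·ˡ a (G ^ˢ i) (b ·ˢ G ^ˢ j) n ⟩
      a * ((G ^ˢ i) ⊛ (b ·ˢ G ^ˢ j)) n   ≈⟨ *-congˡ (⊛-·ʳ b (G ^ˢ i) (G ^ˢ j) n) ⟩
      a * (b * ((G ^ˢ i) ⊛ (G ^ˢ j)) n)  ≈⟨ sym (*-assoc _ _ _) ⟩
      (a * b) * ((G ^ˢ i) ⊛ (G ^ˢ j)) n  ≈⟨ *-congˡ (sym (^ˢ-+ G i j n)) ⟩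
      (a * b) * (G ^ˢ (i ℕ.+ j)) n       ∎

  ⊛∘ˢ : ∀ f g G → ConstFree G → (f ⊛ g) ∘ˢ G ≋ (f ∘ˢ G) ⊛ (g ∘ˢ G)
  ⊛∘ˢ f g G G₀ n = trans (⊛∘ˢ-expand f g G G₀ n) (sym (∘ˢ⊛∘ˢ-expand f g G G₀ n))

  ^ˢ∘ˢ : ∀ f G → ConstFree G → ∀ k → (f ^ˢ k) ∘ˢ G ≋ (f ∘ˢ G) ^ˢ k
  ^ˢ∘ˢ f G G₀ zero    = 𝟙∘ˢ G
  ^ˢ∘ˢ f G G₀ (suc k) =
    ≋-trans (⊛∘ˢ f (f ^ˢ k) G G₀) (⊛-cong ≋-refl (^ˢ∘ˢ f G G₀ k))

  ∘ˢ-assoc : ∀ f H G → ConstFree H → ConstFree G → (f ∘ˢ H) ∘ˢ G ≋ f ∘ˢ (H ∘ˢ G)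
  ∘ˢ-assoc f H G H₀ G₀ n = begin
    ((f ∘ˢ H) ∘ˢ G) n
      ≈⟨ ∑-cong n (λ k k≤n → *-congʳ (∘ˢ-widen f H H₀ k n k≤n)) ⟩
    ∑ n (λ k → ∑ n (λ j → f j * (H ^ˢ j) k) * (G ^ˢ k) n)
      ≈⟨ ∑-cong′ n (λ k → trans (∑-*ʳ n _ _) (∑-cong′ n (λ j → *-assoc _ _ _))) ⟩
    ∑ n (λ k → ∑ n (λ j → f j * ((H ^ˢ j) k * (G ^ˢ k) n)))
      ≈⟨ ∑-swap n n _ ⟩
    ∑ n (λ j → ∑ n (λ k → f j * ((H ^ˢ j) k * (G ^ˢ k) n)))
      ≈⟨ ∑-cong′ n (λ j → sym (∑-*ˡ n _ _)) ⟩
    ∑ n (λ j → f j * ((H ^ˢ j) ∘ˢ G) n)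
      ≈⟨ ∑-cong′ n (λ j → *-congˡ (^ˢ∘ˢ H G G₀ j n)) ⟩
    (f ∘ˢ (H ∘ˢ G)) n ∎

  power-product∘ˢ : ∀ f H P K r → ConstFree H → ConstFree K →
    ((f ∘ˢ H) ^ˢ r ⊛ P) ∘ˢ K ≋ (f ∘ˢ (H ∘ˢ K)) ^ˢ r ⊛ (P ∘ˢ K)
  power-product∘ˢ f H P K r H₀ K₀ =
    ≋-trans (⊛∘ˢ ((f ∘ˢ H) ^ˢ r) P K K₀)
            (⊛-cong {g = P ∘ˢ K} (≋-trans (^ˢ∘ˢ (f ∘ˢ H) K K₀ r)
                                          (^ˢ-cong (∘ˢ-assoc f H K H₀ K₀) r))
                                 ≋-refl)

  ∂ : PS → PS
  ∂ f n = nat (suc n) * f (suc n)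

  ∂-cong : ∀ {f g} → f ≋ g → ∂ f ≋ ∂ g
  ∂-cong f≋g n = *-congˡ (f≋g (suc n))

  ∂-half : ∀ f g n →
    squareSum (suc n) (λ i j → nat i * (f i * g j)) (suc n) ≈ (∂ f ⊛ g) n
  ∂-half f g n = begin
    squareSum (suc n) F (suc n)
      ≈⟨ ∑-shift n _ ⟩
    ∑ (suc n) (λ j → δ j (suc n) * (0# * (f 0 * g j)))
      + ∑ n (λ i → ∑ (suc n) (λ j → δ (i ℕ.+ j) n * F (suc i) j))
      ≈⟨ +-cong (∑-zero (suc n) _ (λ j _ → trans (*-congˡ (zeroˡ _)) (zeroʳ _)))
                (∑-cong′ n (λ i → ∑-trunc _ (ℕP.n≤1+n n) (λ j n<j _ →
                   δ>-kills (i ℕ.+ j) n _ (ℕP.<-≤-trans n<j (ℕP.m≤n+m j i))))) ⟩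
    0# + squareSum n (λ i j → F (suc i) j) n
      ≈⟨ +-identityˡ _ ⟩
    squareSum n (λ i j → F (suc i) j) n
      ≈⟨ ∑-cong′ n (λ i → ∑-cong′ n (λ j → *-congˡ (sym (*-assoc _ _ _)))) ⟩
    squareSum n (λ i j → ∂ f i * g j) n
      ≈⟨ sym (⊛-square (∂ f) g n) ⟩
    (∂ f ⊛ g) n ∎
    where
    F : ℕ → ℕ → Carrier
    F i j = nat i * (f i * g j)

  -- Leibniz: the weight n+1 = i+j of the term f_i g_j splits as i + j.
  ∂-⊛ : ∀ f g → ∂ (f ⊛ g) ≋ ∂ f ⊛ g ⊞ f ⊛ ∂ g
  ∂-⊛ f g n = begin
    nat (suc n) * (f ⊛ g) (suc n)
      ≈⟨ *-congˡ (⊛-square f g (suc n)) ⟩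
    nat (suc n) * squareSum (suc n) F (suc n)
      ≈⟨ trans (∑-*ˡ (suc n) _ _) (∑-cong′ (suc n) (λ i →
           trans (∑-*ˡ (suc n) _ _)
                 (trans (∑-cong′ (suc n) (λ j → split i j)) (∑-+ (suc n) _ _)))) ⟩
    ∑ (suc n) (λ i → ∑ (suc n) (λ j → δ (i ℕ.+ j) (suc n) * (nat i * F i j))
                   + ∑ (suc n) (λ j → δ (i ℕ.+ j) (suc n) * (nat j * F i j)))
      ≈⟨ ∑-+ (suc n) _ _ ⟩
    squareSum (suc n) (λ i j → nat i * F i j) (suc n)
      + squareSum (suc n) (λ i j → nat j * F i j) (suc n)
      ≈⟨ +-congˡ (trans (∑-swap (suc n) (suc n) _)
                        (∑-cong′ (suc n) (λ j → ∑-cong′ (suc n) (λ i →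
                           *-cong (≡⇒≈ (P.cong (λ s → δ s (suc n)) (ℕP.+-comm i j)))
                                  (*-congˡ (*-comm (f i) (g j))))))) ⟩
    squareSum (suc n) (λ i j → nat i * F i j) (suc n)
      + squareSum (suc n) (λ j i → nat j * (g j * f i)) (suc n)
      ≈⟨ +-cong (∂-half f g n) (trans (∂-half g f n) (⊛-comm (∂ g) f n)) ⟩
    (∂ f ⊛ g) n + (f ⊛ ∂ g) n ∎
    where
    F : ℕ → ℕ → Carrier
    F i j = f i * g j
    split : ∀ i j → nat (suc n) * (δ (i ℕ.+ j) (suc n) * F i j) ≈
                    δ (i ℕ.+ j) (suc n) * (nat i * F i j) + δ (i ℕ.+ j) (suc n) * (nat j * F i j)
    split i j = begin
      nat (suc n) * (δ (i ℕ.+ j) (suc n) * F i j)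
        ≈⟨ x∙yz≈y∙xz _ _ _ ⟩
      δ (i ℕ.+ j) (suc n) * (nat (suc n) * F i j)
        ≈⟨ δ-subst (i ℕ.+ j) (suc n) (λ m → nat m * F i j) ⟩
      δ (i ℕ.+ j) (suc n) * (nat (i ℕ.+ j) * F i j)
        ≈⟨ *-congˡ (trans (*-congʳ (nat-+ i j)) (distribʳ _ _ _)) ⟩
      δ (i ℕ.+ j) (suc n) * (nat i * F i j + nat j * F i j)
        ≈⟨ distribˡ _ _ _ ⟩
      δ (i ℕ.+ j) (suc n) * (nat i * F i j) + δ (i ℕ.+ j) (suc n) * (nat j * F i j) ∎

  ∂-^ˢ : ∀ f k → ∂ (f ^ˢ suc k) ≋ nat (suc k) ·ˢ ((f ^ˢ k) ⊛ ∂ f)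
  ∂-^ˢ f zero n = begin
    ∂ (f ⊛ 𝟙) n              ≈⟨ ∂-cong (⊛-identityʳ f) n ⟩
    ∂ f n                    ≈⟨ sym (⊛-identityˡ (∂ f) n) ⟩
    (𝟙 ⊛ ∂ f) n              ≈⟨ sym (*-identityˡ _) ⟩
    1# * (𝟙 ⊛ ∂ f) n         ≈⟨ *-congʳ (sym (+-identityʳ 1#)) ⟩
    nat 1 * (𝟙 ⊛ ∂ f) n      ∎
  ∂-^ˢ f (suc k) n = begin
    ∂ (f ⊛ f ^ˢ suc k) n
      ≈⟨ ∂-⊛ f (f ^ˢ suc k) n ⟩
    (∂ f ⊛ f ^ˢ suc k) n + (f ⊛ ∂ (f ^ˢ suc k)) n
      ≈⟨ +-cong (⊛-comm (∂ f) _ n) (begin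
           (f ⊛ ∂ (f ^ˢ suc k)) n                    ≈⟨ ⊛-cong ≋-refl (∂-^ˢ f k) n ⟩
           (f ⊛ (nat (suc k) ·ˢ (f ^ˢ k ⊛ ∂ f))) n    ≈⟨ ⊛-·ʳ (nat (suc k)) f (f ^ˢ k ⊛ ∂ f) n ⟩
           nat (suc k) * (f ⊛ (f ^ˢ k ⊛ ∂ f)) n      ≈⟨ *-congˡ (sym (⊛-assoc f (f ^ˢ k) (∂ f) n)) ⟩
           nat (suc k) * X                           ∎) ⟩
    X + nat (suc k) * X      ≈⟨ +-congʳ (sym (*-identityˡ X)) ⟩
    1# * X + nat (suc k) * X ≈⟨ sym (distribʳ _ _ _) ⟩
    nat (suc (suc k)) * X    ∎
    where
    X : Carrier
    X = (f ^ˢ suc k ⊛ ∂ f) n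

  ∂-∘ˢ : ∀ f G → ConstFree G → ∂ (f ∘ˢ G) ≋ (∂ f ∘ˢ G) ⊛ ∂ G
  ∂-∘ˢ f G G₀ n = begin
    nat (suc n) * ∑ (suc n) (λ k → f k * (G ^ˢ k) (suc n))
      ≈⟨ trans (∑-*ˡ (suc n) _ _) (∑-cong′ (suc n) (λ k → x∙yz≈y∙xz _ _ _)) ⟩
    ∑ (suc n) (λ k → f k * ∂ (G ^ˢ k) n)
      ≈⟨ ∑-shift n _ ⟩
    f 0 * (nat (suc n) * 0#) + ∑ n (λ k → f (suc k) * ∂ (G ^ˢ suc k) n)
      ≈⟨ +-cong (trans (*-congˡ (zeroʳ _)) (zeroʳ _))
                (∑-cong′ n (λ k → *-congˡ (∂-^ˢ G k n))) ⟩
    0# + ∑ n (λ k → f (suc k) * (nat (suc k) * (G ^ˢ k ⊛ ∂ G) n))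
      ≈⟨ +-identityˡ _ ⟩
    ∑ n (λ k → f (suc k) * (nat (suc k) * (G ^ˢ k ⊛ ∂ G) n))
      ≈⟨ ∑-cong′ n (λ k → trans (sym (*-assoc _ _ _)) (*-congʳ (*-comm _ _))) ⟩
    ∑ n (λ k → ∂ f k * (G ^ˢ k ⊛ ∂ G) n)
      ≈⟨ ∑-cong′ n (λ k → sym (⊛-·ˡ (∂ f k) (G ^ˢ k) (∂ G) n)) ⟩
    ∑ n (λ k → ((∂ f k ·ˢ G ^ˢ k) ⊛ ∂ G) n)
      ≈⟨ sym (⊛-∑ˡ n n (λ k → ∂ f k ·ˢ G ^ˢ k) (∂ G)) ⟩
    ((λ m → ∑ n (λ k → ∂ f k * (G ^ˢ k) m)) ⊛ ∂ G) n
      ≈⟨ sym (⊛-local n {g = ∂ G} (λ m m≤n → ∘ˢ-widen (∂ f) G G₀ m n m≤n)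
                                  (λ _ _ → refl)) ⟩
    ((∂ f ∘ˢ G) ⊛ ∂ G) n ∎

  lin : Carrier → PS
  lin a = 𝟙 ⊞ a ·ˢ t

  lin⊛ : ∀ a h n → (lin a ⊛ h) n ≈ h n + a * (t ⊛ h) n
  lin⊛ a h n = trans (⊛-distribʳ h 𝟙 (a ·ˢ t) n) (+-cong (⊛-identityˡ h n) (⊛-·ˡ a t h n))

  lin⊛-zero : ∀ a h → (lin a ⊛ h) 0 ≈ h 0
  lin⊛-zero a h = begin
    (lin a ⊛ h) 0          ≈⟨ lin⊛ a h 0 ⟩
    h 0 + a * (t ⊛ h) 0    ≈⟨ +-congˡ (trans (*-congˡ (t⊛-zero h)) (zeroʳ a)) ⟩
    h 0 + 0#               ≈⟨ +-identityʳ _ ⟩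
    h 0                    ∎

  lin⊛-suc : ∀ a h n → (lin a ⊛ h) (suc n) ≈ h (suc n) + a * h n
  lin⊛-suc a h n = trans (lin⊛ a h (suc n)) (+-congˡ (*-congˡ (t⊛-suc h n)))

  lin∘ˢ : ∀ a G → ConstFree G → lin a ∘ˢ G ≋ 𝟙 ⊞ a ·ˢ G
  lin∘ˢ a G G₀ n = trans (∘ˢ-⊞ 𝟙 (a ·ˢ t) G n)
    (+-cong (𝟙∘ˢ G n) (trans (∘ˢ-· a t G n) (*-congˡ (t∘ˢ G G₀ n))))

  𝟙⊞minusOne : ∀ f → 𝟙 ⊞ minusOneS R inv f ≋ f
  𝟙⊞minusOne f zero    = trans (+-comm _ _) (minus-plus (f 0) 1#)
  𝟙⊞minusOne f (suc n) = +-identityˡ _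

  lin∘minusOne : ∀ f → ConstFree (minusOneS R inv f) → lin 1# ∘ˢ minusOneS R inv f ≋ f
  lin∘minusOne f f₀ n = trans (lin∘ˢ 1# _ f₀ n)
                              (trans (+-congˡ (*-identityˡ _)) (𝟙⊞minusOne f n))

  minusOne-cong : ∀ {f g} → f ≋ g → minusOneS R inv f ≋ minusOneS R inv g
  minusOne-cong f≋g zero    = +-congʳ (f≋g 0)
  minusOne-cong f≋g (suc n) = f≋g (suc n)

  minusOne≋ : ∀ f → minusOneS R inv f ≋ f ⊞ (- 1#) ·ˢ 𝟙
  minusOne≋ f zero    = +-congˡ (sym (*-identityʳ _))
  minusOne≋ f (suc n) = sym (trans (+-congˡ (zeroʳ _)) (+-identityʳ _))

  minusOne∘ˢ : ∀ f G → minusOneS R inv f ∘ˢ G ≋ minusOneS R inv (f ∘ˢ G)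
  minusOne∘ˢ f G n = begin
    (minusOneS R inv f ∘ˢ G) n
      ≈⟨ ∘ˢ-congˡ G (minusOne≋ f) n ⟩
    ((f ⊞ (- 1#) ·ˢ 𝟙) ∘ˢ G) n
      ≈⟨ ∘ˢ-⊞ f _ G n ⟩
    (f ∘ˢ G) n + (((- 1#) ·ˢ 𝟙) ∘ˢ G) n
      ≈⟨ +-congˡ (trans (∘ˢ-· (- 1#) 𝟙 G n) (*-congˡ (𝟙∘ˢ G n))) ⟩
    (f ∘ˢ G ⊞ (- 1#) ·ˢ 𝟙) n
      ≈⟨ sym (minusOne≋ (f ∘ˢ G) n) ⟩
    minusOneS R inv (f ∘ˢ G) n ∎

-- Then the derivative determines a series up to its constant term,
-- which identifies the compositions the theorem is about.
module InvertibleIntegers {c ℓ : Level} (R : CommutativeRing c ℓ)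
  (inv : ℕ → CommutativeRing.Carrier R)
  (inv-correct : ∀ n → CommutativeRing._≈_ R
                   (CommutativeRing._*_ R (natR R inv (suc n)) (inv n)) (CommutativeRing.1# R))
  where

  open CommutativeRing R hiding (zero)
  open PowerSeries R inv
  open SetoidReasoning setoid
  open CommSemigroupProperties *-commutativeSemigroup using (x∙yz≈y∙xz)
  open import Algebra.Properties.Ring ring using (-0#≈0#)
  import Algebra.Solver.CommutativeMonoid *-commutativeMonoid as *-Solver
  open *-Solver using (_⊕_; _⊜_)

  nat-inv : ∀ n a → nat (suc n) * (inv n * a) ≈ a
  nat-inv n a = begin
    nat (suc n) * (inv n * a) ≈⟨ sym (*-assoc _ _ _) ⟩
    (nat (suc n) * inv n) * a ≈⟨ *-congʳ (inv-correct n) ⟩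
    1# * a                    ≈⟨ *-identityˡ a ⟩
    a                         ∎

  inv-nat : ∀ n a → inv n * (nat (suc n) * a) ≈ a
  inv-nat n a = trans (x∙yz≈y∙xz (inv n) (nat (suc n)) a) (nat-inv n a)

  nat-cancel : ∀ n {a b} → nat (suc n) * a ≈ nat (suc n) * b → a ≈ b
  nat-cancel n {a} {b} h = begin
    a                         ≈⟨ sym (inv-nat n a) ⟩
    inv n * (nat (suc n) * a) ≈⟨ *-congˡ h ⟩
    inv n * (nat (suc n) * b) ≈⟨ inv-nat n b ⟩
    b                         ∎

  ∂-injective : ∀ f g → ∂ f ≋ ∂ g → f 0 ≈ g 0 → f ≋ g
  ∂-injective f g ∂f≋∂g f₀≈g₀ zero    = f₀≈g₀
  ∂-injective f g ∂f≋∂g f₀≈g₀ (suc n) = nat-cancel n (∂f≋∂g n)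

  SolvesODE : Carrier → Carrier → PS → Set ℓ
  SolvesODE a y f = lin a ⊛ ∂ f ≋ y ·ˢ f

  -- Solutions of (1 + a t) f′ = y f are determined by their constant term:
  -- the equation at tⁿ⁺¹ reads f′_{n+1} + a f′_n = y f_{n+1}, so the
  -- coefficients f_n and f′_n are determined inductively.
  ODE-unique : ∀ a y f g → SolvesODE a y f → SolvesODE a y g → f 0 ≈ g 0 → f ≋ g
  ODE-unique a y f g f-sol g-sol f₀≈g₀ n = proj₁ (step n)
    where
    step : ∀ n → (f n ≈ g n) × (∂ f n ≈ ∂ g n)
    step zero = f₀≈g₀ , (begin
      ∂ f 0              ≈⟨ sym (lin⊛-zero a (∂ f)) ⟩
      (lin a ⊛ ∂ f) 0    ≈⟨ f-sol 0 ⟩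
      y * f 0            ≈⟨ *-congˡ f₀≈g₀ ⟩
      y * g 0            ≈⟨ sym (g-sol 0) ⟩
      (lin a ⊛ ∂ g) 0    ≈⟨ lin⊛-zero a (∂ g) ⟩
      ∂ g 0              ∎)
    step (suc n) with step n
    ... | _ , ∂fₙ≈∂gₙ = fₙ₊₁≈gₙ₊₁ , +-cancelʳ (a * ∂ f n) (begin
      ∂ f (suc n) + a * ∂ f n      ≈⟨ sym (lin⊛-suc a (∂ f) n) ⟩
      (lin a ⊛ ∂ f) (suc n)        ≈⟨ f-sol (suc n) ⟩
      y * f (suc n)                ≈⟨ *-congˡ fₙ₊₁≈gₙ₊₁ ⟩
      y * g (suc n)                ≈⟨ sym (g-sol (suc n)) ⟩
      (lin a ⊛ ∂ g) (suc n)        ≈⟨ lin⊛-suc a (∂ g) n ⟩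
      ∂ g (suc n) + a * ∂ g n      ≈⟨ +-congˡ (*-congˡ (sym ∂fₙ≈∂gₙ)) ⟩
      ∂ g (suc n) + a * ∂ f n      ∎)
      where
      fₙ₊₁≈gₙ₊₁ : f (suc n) ≈ g (suc n)
      fₙ₊₁≈gₙ₊₁ = nat-cancel n ∂fₙ≈∂gₙ

  eλ : Carrier → Carrier → PS
  eλ y lam = degPowS R inv y lam

  -- Coefficientwise, (e_λ^y)′_m = (y - mλ) (e_λ^y)_m, since (y)_{m+1,λ} = (y)_{m,λ} (y - mλ).
  ∂-eλ : ∀ y lam m → ∂ (eλ y lam) m ≈ (y - nat m * lam) * eλ y lam m
  ∂-eλ y lam m = begin
    nat (suc m) * ((falls * step) * (inv m * invFact R inv m))
      ≈⟨ *-congˡ (*-Solver.solve 4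
                    (λ a b d e → ((a ⊕ b) ⊕ (d ⊕ e)) ⊜ (d ⊕ (b ⊕ (a ⊕ e))))
                    refl falls step (inv m) (invFact R inv m)) ⟩
    nat (suc m) * (inv m * (step * eλ y lam m))
      ≈⟨ nat-inv m _ ⟩
    step * eλ y lam m ∎
    where
    falls step : Carrier
    falls = degFalling R inv y lam m
    step  = y - nat m * lam

  eλ-ODE : ∀ y lam → SolvesODE lam y (eλ y lam)
  eλ-ODE y lam zero = begin
    (lin lam ⊛ ∂ (eλ y lam)) 0    ≈⟨ lin⊛-zero lam (∂ (eλ y lam)) ⟩
    ∂ (eλ y lam) 0                ≈⟨ ∂-eλ y lam 0 ⟩
    (y - 0# * lam) * eλ y lam 0   ≈⟨ *-congʳ y-0·λ≈y ⟩
    y * eλ y lam 0                ∎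
    where
    y-0·λ≈y : y - 0# * lam ≈ y
    y-0·λ≈y = trans (+-congˡ (trans (-‿cong (zeroˡ lam)) -0#≈0#)) (+-identityʳ y)
  eλ-ODE y lam (suc m) = begin
    (lin lam ⊛ ∂ (eλ y lam)) (suc m)
      ≈⟨ lin⊛-suc lam (∂ (eλ y lam)) m ⟩
    ∂ (eλ y lam) (suc m) + lam * (nat (suc m) * eλ y lam (suc m))
      ≈⟨ +-cong (∂-eλ y lam (suc m)) (trans (sym (*-assoc _ _ _)) (*-congʳ (*-comm lam _))) ⟩
    (y - N) * eλ y lam (suc m) + N * eλ y lam (suc m)
      ≈⟨ sym (distribʳ _ _ _) ⟩
    ((y - N) + N) * eλ y lam (suc m)
      ≈⟨ *-congʳ (minus-plus y N) ⟩
    y * eλ y lam (suc m) ∎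
    where
    N : Carrier
    N = nat (suc m) * lam

  binom≋eλ : ∀ x → binomS R inv x ≋ eλ x 1#
  binom≋eλ x m = *-congʳ (falling≈ m)
    where
    falling≈ : ∀ m → falling R inv x m ≈ degFalling R inv x 1# m
    falling≈ zero    = refl
    falling≈ (suc m) = *-cong (falling≈ m) (+-congˡ (-‿cong (sym (*-identityʳ _))))

  binom-ODE : ∀ x → SolvesODE 1# x (binomS R inv x)
  binom-ODE x = ≋-trans (⊛-cong ≋-refl (∂-cong (binom≋eλ x)))
                        (≋-trans (eλ-ODE x 1#) (λ n → *-congˡ (sym (binom≋eλ x n))))

  log : PS
  log = log1pS R inv

  ∂-log : ∀ n → ∂ log n ≈ sign R inv n
  ∂-log n = trans (*-congˡ (*-comm _ _)) (nat-inv n _)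

  log-ODE : lin 1# ⊛ ∂ log ≋ 𝟙
  log-ODE zero    = trans (lin⊛-zero 1# (∂ log)) (∂-log 0)
  log-ODE (suc m) = begin
    (lin 1# ⊛ ∂ log) (suc m)             ≈⟨ lin⊛-suc 1# (∂ log) m ⟩
    ∂ log (suc m) + 1# * ∂ log m         ≈⟨ +-cong (∂-log (suc m)) (trans (*-identityˡ _) (∂-log m)) ⟩
    - sign R inv m + sign R inv m        ≈⟨ -‿inverseˡ _ ⟩
    0#                                   ∎

  exp : PS
  exp = invFact R inv

  ∂-exp : ∂ exp ≋ exp
  ∂-exp n = nat-inv n (invFact R inv n)

  G : PS
  G = minusOneS R inv exp

  G-constFree : ConstFree G
  G-constFree = -‿inverseʳ 1#

  -- log(1 + G) = t, as both sides have derivative 1 and constant term 0.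
  log∘G : log ∘ˢ G ≋ t
  log∘G = ∂-injective (log ∘ˢ G) t ∂-agree (zeroˡ _)
    where
    ∂-agree : ∂ (log ∘ˢ G) ≋ ∂ t
    ∂-agree n = begin
      ∂ (log ∘ˢ G) n                        ≈⟨ ∂-∘ˢ log G G-constFree n ⟩
      ((∂ log ∘ˢ G) ⊛ ∂ exp) n              ≈⟨ ⊛-cong ≋-refl (≋-trans ∂-exp
                                                  (≋-sym (lin∘minusOne exp G-constFree))) n ⟩
      ((∂ log ∘ˢ G) ⊛ (lin 1# ∘ˢ G)) n      ≈⟨ sym (⊛∘ˢ (∂ log) (lin 1#) G G-constFree n) ⟩
      ((∂ log ⊛ lin 1#) ∘ˢ G) n             ≈⟨ ∘ˢ-congˡ G (≋-trans (⊛-comm (∂ log) (lin 1#))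
                                                                  log-ODE) n ⟩
      (𝟙 ∘ˢ G) n                            ≈⟨ 𝟙∘ˢ G n ⟩
      𝟙 n                                   ≈⟨ sym (∂t n) ⟩
      ∂ t n                                 ∎
      where
      ∂t : ∂ t ≋ 𝟙
      ∂t zero    = trans (*-identityʳ _) (+-identityʳ 1#)
      ∂t (suc n) = zeroʳ _

  ∘log∘G : ∀ f → (f ∘ˢ log) ∘ˢ G ≋ f
  ∘log∘G f = ≋-trans (∘ˢ-assoc f log G refl G-constFree)
                     (≋-trans (∘ˢ-congʳ f log∘G) (∘ˢt f))

  fact-invFact : ∀ m → factR R inv m * invFact R inv m ≈ 1#
  fact-invFact zero    = *-identityˡ 1#
  fact-invFact (suc m) = begin
    (nat (suc m) * factR R inv m) * (inv m * invFact R inv m)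
      ≈⟨ *-Solver.solve 4 (λ a b d e → ((a ⊕ b) ⊕ (d ⊕ e)) ⊜ ((a ⊕ d) ⊕ (b ⊕ e)))
                          refl _ _ _ _ ⟩
    (nat (suc m) * inv m) * (factR R inv m * invFact R inv m)
      ≈⟨ *-cong (inv-correct m) (fact-invFact m) ⟩
    1# * 1#
      ≈⟨ *-identityˡ 1# ⟩
    1# ∎

  stirlingCoeff : ℕ → ℕ → Carrier
  stirlingCoeff m n = invFact R inv m * (G ^ˢ m) n

  -- Differentiating G^{m+1}/(m+1)! = G^m/m! · (1 + G) gives the recurrence
  -- (n+1) c_{m+1,n+1} = c_{m,n} + (m+1) c_{m+1,n}.
  stirlingCoeff-rec : ∀ m n → nat (suc n) * stirlingCoeff (suc m) (suc n) ≈
                             stirlingCoeff m n + nat (suc m) * stirlingCoeff (suc m) n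
  stirlingCoeff-rec m n = begin
    nat (suc n) * (iF (suc m) * (G ^ˢ suc m) (suc n))
      ≈⟨ x∙yz≈y∙xz _ _ _ ⟩
    iF (suc m) * ∂ (G ^ˢ suc m) n
      ≈⟨ *-congˡ (∂-^ˢ G m n) ⟩
    iF (suc m) * (nat (suc m) * (G ^ˢ m ⊛ ∂ G) n)
      ≈⟨ trans (x∙yz≈y∙xz _ _ _) (*-congˡ (*-assoc _ _ _)) ⟩
    nat (suc m) * (inv m * (iF m * (G ^ˢ m ⊛ ∂ G) n))
      ≈⟨ nat-inv m _ ⟩
    iF m * (G ^ˢ m ⊛ ∂ G) n
      ≈⟨ *-congˡ (⊛-cong ≋-refl (≋-trans ∂-exp (≋-sym (𝟙⊞minusOne exp))) n) ⟩
    iF m * (G ^ˢ m ⊛ (𝟙 ⊞ G)) n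
      ≈⟨ *-congˡ (trans (⊛-distribˡ (G ^ˢ m) 𝟙 G n)
                        (+-cong (⊛-identityʳ (G ^ˢ m) n) (⊛-comm (G ^ˢ m) G n))) ⟩
    iF m * ((G ^ˢ m) n + (G ^ˢ suc m) n)
      ≈⟨ distribˡ _ _ _ ⟩
    stirlingCoeff m n + iF m * (G ^ˢ suc m) n
      ≈⟨ +-congˡ (*-congʳ (sym (nat-inv m (iF m)))) ⟩
    stirlingCoeff m n + (nat (suc m) * iF (suc m)) * (G ^ˢ suc m) n
      ≈⟨ +-congˡ (*-assoc _ _ _) ⟩
    stirlingCoeff m n + nat (suc m) * stirlingCoeff (suc m) n ∎
    where
    iF : ℕ → Carrier
    iF = invFact R inv

  -- Both sides satisfy the recurrence of S₂ and agree for n = 0.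
  S₂≈stirlingCoeff : ∀ n m → nat (S₂ n m) ≈ factR R inv n * stirlingCoeff m n
  S₂≈stirlingCoeff zero zero =
    trans (+-identityʳ 1#) (sym (trans (*-identityˡ _) (*-identityˡ 1#)))
  S₂≈stirlingCoeff zero (suc m) = sym (begin
    1# * (invFact R inv (suc m) * (G ^ˢ suc m) 0)
      ≈⟨ *-identityˡ _ ⟩
    invFact R inv (suc m) * (G ^ˢ suc m) 0
      ≈⟨ *-congˡ (^ˢ-low G G-constFree (suc m) 0 (s≤s z≤n)) ⟩
    invFact R inv (suc m) * 0#
      ≈⟨ zeroʳ _ ⟩
    0# ∎)
  S₂≈stirlingCoeff (suc n) zero = sym (trans (*-congˡ (zeroʳ _)) (zeroʳ _))
  S₂≈stirlingCoeff (suc n) (suc m) = begin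
    nat (suc m ℕ.* S₂ n (suc m) ℕ.+ S₂ n m)
      ≈⟨ trans (nat-+ (suc m ℕ.* S₂ n (suc m)) (S₂ n m))
               (+-congʳ (nat-* (suc m) (S₂ n (suc m)))) ⟩
    nat (suc m) * nat (S₂ n (suc m)) + nat (S₂ n m)
      ≈⟨ +-cong (*-congˡ (S₂≈stirlingCoeff n (suc m))) (S₂≈stirlingCoeff n m) ⟩
    nat (suc m) * (n! * stirlingCoeff (suc m) n) + n! * stirlingCoeff m n
      ≈⟨ trans (+-congʳ (x∙yz≈y∙xz _ _ _))
               (trans (sym (distribˡ _ _ _)) (*-congˡ (+-comm _ _))) ⟩
    n! * (stirlingCoeff m n + nat (suc m) * stirlingCoeff (suc m) n)
      ≈⟨ *-congˡ (sym (stirlingCoeff-rec m n)) ⟩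
    n! * (nat (suc n) * stirlingCoeff (suc m) (suc n))
      ≈⟨ trans (x∙yz≈y∙xz _ _ _) (sym (*-assoc _ _ _)) ⟩
    factR R inv (suc n) * stirlingCoeff (suc m) (suc n) ∎
    where
    n! : Carrier
    n! = factR R inv n

  factorial-∘ˢ : ∀ P H n →
    ∑ n (λ m → (factR R inv m * P m) * (factR R inv n * (invFact R inv m * (H ^ˢ m) n)))
      ≈ factR R inv n * (P ∘ˢ H) n
  factorial-∘ˢ P H n = begin
    ∑ n (λ m → (factR R inv m * P m) * (factR R inv n * (invFact R inv m * (H ^ˢ m) n)))
      ≈⟨ ∑-cong′ n (λ m → *-Solver.solve 5
           (λ a b d e g → ((a ⊕ b) ⊕ (d ⊕ (e ⊕ g))) ⊜ (d ⊕ ((a ⊕ e) ⊕ (b ⊕ g))))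
           refl _ _ _ _ _) ⟩
    ∑ n (λ m → factR R inv n * ((factR R inv m * invFact R inv m) * (P m * (H ^ˢ m) n)))
      ≈⟨ ∑-cong′ n (λ m → *-congˡ (trans (*-congʳ (fact-invFact m)) (*-identityˡ _))) ⟩
    ∑ n (λ m → factR R inv n * (P m * (H ^ˢ m) n))
      ≈⟨ sym (∑-*ˡ n _ _) ⟩
    factR R inv n * (P ∘ˢ H) n ∎

  Eλ : Carrier → PS
  Eλ lam = minusOneS R inv (eλ 1# lam)

  Eλ-constFree : ∀ lam → ConstFree (Eλ lam)
  Eλ-constFree lam = trans (+-congʳ (*-identityˡ 1#)) (-‿inverseʳ 1#)

  -- (1 + u)^x evaluated at u = e_λ(t) - 1 is e_λ^x(t): both sides solve
  -- (1 + λt) f′ = x f with f(0) = 1.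
  binom∘Eλ : ∀ lam x → binomS R inv x ∘ˢ Eλ lam ≋ eλ x lam
  binom∘Eλ lam x = ODE-unique lam x (b ∘ˢ E) (eλ x lam) b∘E-ODE (eλ-ODE x lam) (*-identityʳ _)
    where
    b e E : PS
    b = binomS R inv x
    e = eλ 1# lam
    E = Eλ lam

    E₀ : ConstFree E
    E₀ = Eλ-constFree lam

    b∘E-ODE : SolvesODE lam x (b ∘ˢ E)
    b∘E-ODE n = begin
      (lin lam ⊛ ∂ (b ∘ˢ E)) n              ≈⟨ ⊛-cong ≋-refl (∂-∘ˢ b E E₀) n ⟩
      (lin lam ⊛ ((∂ b ∘ˢ E) ⊛ ∂ e)) n
        ≈⟨ ⊛-leftComm (lin lam) (∂ b ∘ˢ E) (∂ e) n ⟩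
      ((∂ b ∘ˢ E) ⊛ (lin lam ⊛ ∂ e)) n
        ≈⟨ ⊛-cong ≋-refl (≋-trans (eλ-ODE 1# lam) (λ k →
             trans (*-identityˡ _) (sym (lin∘minusOne e E₀ k)))) n ⟩
      ((∂ b ∘ˢ E) ⊛ (lin 1# ∘ˢ E)) n
        ≈⟨ sym (⊛∘ˢ (∂ b) (lin 1#) E E₀ n) ⟩
      ((∂ b ⊛ lin 1#) ∘ˢ E) n
        ≈⟨ ∘ˢ-congˡ E (≋-trans (⊛-comm (∂ b) (lin 1#)) (binom-ODE x)) n ⟩
      ((x ·ˢ b) ∘ˢ E) n
        ≈⟨ ∘ˢ-· x b E n ⟩
      x * (b ∘ˢ E) n ∎

  module Changhee (lam x : Carrier) (r : ℕ) where

    twoOverTwoPlus : PS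
    twoOverTwoPlus k = powR R inv (- half R inv) k

    A : PS
    A = (twoOverTwoPlus ∘ˢ t) ^ˢ r ⊛ binomS R inv x

    Dλ : PS
    Dλ = minusOneS R inv (degLogPowS R inv 1# lam)

    Dλ-constFree : ConstFree Dλ
    Dλ-constFree = trans (+-congʳ (trans (*-identityʳ _) (*-identityˡ _))) (-‿inverseʳ 1#)

    B : PS
    B = (twoOverTwoPlus ∘ˢ Dλ) ^ˢ r ⊛ (eλ x lam ∘ˢ log)

    T : PS
    T = (twoOverTwoPlus ∘ˢ Eλ lam) ^ˢ r ⊛ eλ x lam

    -- A(Eλ) = T, since t ∘ Eλ = Eλ and (1 + u)^x ∘ Eλ = e_λ^x.
    A∘Eλ : A ∘ˢ Eλ lam ≋ T
    A∘Eλ = ≋-trans (power-product∘ˢ twoOverTwoPlus t (binomS R inv x) (Eλ lam) r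
                                    refl (Eλ-constFree lam))
                   (⊛-cong (^ˢ-cong (∘ˢ-congʳ twoOverTwoPlus (t∘ˢ (Eλ lam) (Eλ-constFree lam))) r)
                           (binom∘Eλ lam x))

    -- B(G) = T, because substituting G undoes the logarithm: Dλ ∘ G = Eλ.
    B∘G : B ∘ˢ G ≋ T
    B∘G = ≋-trans (power-product∘ˢ twoOverTwoPlus Dλ (eλ x lam ∘ˢ log) G r
                                   Dλ-constFree G-constFree)
                  (⊛-cong (^ˢ-cong (∘ˢ-congʳ twoOverTwoPlus Dλ∘G) r) (∘log∘G (eλ x lam)))
      where
      Dλ∘G : Dλ ∘ˢ G ≋ Eλ lam
      Dλ∘G = ≋-trans (minusOne∘ˢ (eλ 1# lam ∘ˢ log) G) (minusOne-cong (∘log∘G (eλ 1# lam)))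

theorem2p11 : {c ℓ : Level} (R : CommutativeRing c ℓ)
    (inv : ℕ → CommutativeRing.Carrier R) →
    (∀ n → CommutativeRing._≈_ R (CommutativeRing._*_ R (natR R inv (suc n)) (inv n)) (CommutativeRing.1# R)) →
    (lam x : CommutativeRing.Carrier R) →
    ¬ (CommutativeRing._≈_ R lam (CommutativeRing.0# R)) →
    (r n : ℕ) →
    CommutativeRing._≈_ R
      (sumTo R inv n (λ m → CommutativeRing._*_ R (Ch R inv r x m) (S₂λ R inv lam n m)))
      (sumTo R inv n (λ m → CommutativeRing._*_ R (ChDeg R inv r lam x m) (natR R inv (S₂ n m))))
theorem2p11 R inv inv-correct lam x _ r n = begin
  ∑ n (λ m → Ch R inv r x m * S₂λ R inv lam n m)
    ≈⟨ factorial-∘ˢ A (Eλ lam) n ⟩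
  n! * (A ∘ˢ Eλ lam) n
    ≈⟨ *-congˡ (trans (A∘Eλ n) (sym (B∘G n))) ⟩
  n! * (B ∘ˢ G) n
    ≈⟨ sym (factorial-∘ˢ B G n) ⟩
  ∑ n (λ m → ChDeg R inv r lam x m * (n! * stirlingCoeff m n))
    ≈⟨ ∑-cong′ n (λ m → *-congˡ (sym (S₂≈stirlingCoeff n m))) ⟩
  ∑ n (λ m → ChDeg R inv r lam x m * natR R inv (S₂ n m)) ∎
  where
  open CommutativeRing R using (_*_; setoid; trans; sym; *-congˡ)
  open SetoidReasoning setoid
  open PowerSeries R inv using (∑; ∑-cong′; _∘ˢ_)
  open InvertibleIntegers R inv inv-correct
  open Changhee lam x r
  n! : CommutativeRing.Carrier R
  n! = factR R inv n
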